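{- For the Web graph $\mathbb{W}_{n}$ with $n\ge 4$, the independent mixed metric number of $\mathbb{W}_{n}$ equals $n+1$.
   Context: For an integer $n\ge 3$, the Web graph $\mathbb{W}_{n}$ has vertex set $\{p_i,q_i,r_i : 1\le i\le n\}$ and edge set $\{p_iq_i,\ p_ip_{i+1},\ q_iq_{i+1},\ q_ir_i : 1\le i\le n\}$, with indices taken modulo $n$. For a connected graph $H$, $d_H(u,v)$ is the shortest-path distance, and for a vertex $x$ and an edge $e=uv$, $d_H(x,e)=\min\{d_H(x,u),d_H(x,v)\}$. A set $M\subseteq V(H)$ is a mixed metric generator of $H$ if for every two distinct elements $y_1,y_2\in V(H)\cup E(H)$ there is a vertex $z\in M$ with $d_H(z,y_1)\ne d_H(z,y_2)$. An independent mixed metric generator is a mixed metric generator that is an independent set (no two of its vertices are adjacent); the independent mixed metric number of $H$ is the minimum cardinality of an independent mixed metric generator of $H$. -}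

module Defs where

open import Data.Nat using (ℕ; zero; suc; _≤_; _⊓_; _%_; NonZero)
open import Data.Fin using (Fin; toℕ)
open import Data.Product using (Σ; _×_; _,_; ∃)
open import Data.Sum using (_⊎_; inj₁; inj₂)
open import Data.List using (List; length)
open import Data.List.Membership.Propositional using (_∈_)
open import Data.List.Relation.Unary.Unique.Propositional using (Unique)
open import Relation.Binary.PropositionalEquality using (_≡_; _≢_)
open import Relation.Nullary using (¬_)
open import Data.Empty using (⊥)

module _ {V : Set} (adj : V → V → Set) where

  data Walk : V → V → ℕ → Set where
    here : ∀ {u} → Walk u u 0
    step : ∀ {u w v k} → adj u w → Walk w v k → Walk u v (suc k)

  Dist : V → V → ℕ → Set
  Dist u v k = Walk u v k × (∀ j → Walk u v j → k ≤ j)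

  -- edges: ordered pairs of adjacent vertices, identified up to orientation
  Edge : Set
  Edge = Σ (V × V) (λ { (u , v) → adj u v })

  Elem : Set
  Elem = V ⊎ Edge

  SameElem : Elem → Elem → Set
  SameElem (inj₁ x) (inj₁ y) = x ≡ y
  SameElem (inj₁ x) (inj₂ e) = ⊥
  SameElem (inj₂ e) (inj₁ y) = ⊥
  SameElem (inj₂ ((u , v) , _)) (inj₂ ((u' , v') , _)) =
    (u ≡ u' × v ≡ v') ⊎ (u ≡ v' × v ≡ u')

  DistEl : V → Elem → ℕ → Set
  DistEl x (inj₁ y) k = Dist x y k
  DistEl x (inj₂ ((u , v) , _)) k =
    Σ ℕ λ a → Σ ℕ λ b → Dist x u a × Dist x v b × k ≡ a ⊓ b

  Distinguishes : V → Elem → Elem → Set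
  Distinguishes z y₁ y₂ = ∀ a b → DistEl z y₁ a → DistEl z y₂ b → a ≢ b

  -- mixed metric generator (M a list of vertices, viewed as a set)
  MixedMetricGenerator : List V → Set
  MixedMetricGenerator M =
    ∀ (y₁ y₂ : Elem) → ¬ SameElem y₁ y₂ →
      Σ V λ z → z ∈ M × Distinguishes z y₁ y₂

  IndependentSet : List V → Set
  IndependentSet M = ∀ x y → x ∈ M → y ∈ M → ¬ adj x y

  IndependentMixedMetricGenerator : List V → Set
  IndependentMixedMetricGenerator M =
    IndependentSet M × MixedMetricGenerator M

  IndependentMixedMetricNumber≡ : ℕ → Set
  IndependentMixedMetricNumber≡ m =
    (Σ (List V) λ M → Unique M × IndependentMixedMetricGenerator M × length M ≡ m)
    × (∀ M → Unique M → IndependentMixedMetricGenerator M → m ≤ length M)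

data Kind : Set where
  p q r : Kind

WebVertex : ℕ → Set
WebVertex n = Kind × Fin n

Next : (n : ℕ) → .{{NonZero n}} → Fin n → Fin n → Set
Next n i j = toℕ j ≡ suc (toℕ i) % n

data WebEdge (n : ℕ) .{{_ : NonZero n}} : WebVertex n → WebVertex n → Set where
  pq : ∀ i → WebEdge n (p , i) (q , i)
  pp : ∀ i j → Next n i j → WebEdge n (p , i) (p , j)
  qq : ∀ i j → Next n i j → WebEdge n (q , i) (q , j)
  qr : ∀ i → WebEdge n (q , i) (r , i)

WebAdj : (n : ℕ) → .{{NonZero n}} → WebVertex n → WebVertex n → Set
WebAdj n x y = WebEdge n x y ⊎ WebEdge n y x

-- From any vertex other than r_i, q_i is no farther than r_i, so r_i is the only vertex
-- telling q_i from the edge q_i r_i: every r_i is a landmark. Seen from every r_i, q₀ and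
-- the edge q₀p₀ look alike, so one more landmark is needed. Conversely {p₀, r_1, …, r_n}
-- suffices: the distance from r_i to an element at position j is minimal (with a minimum
-- depending only on the kind of the element) exactly when i = j, or i = j + 1 for the edges
-- along the two cycles. So the r_i recover the position and almost the kind of an element;
-- the remaining pairs, q_j against p_j q_j and r_j against q_j r_j, are told apart by p₀.

module Submission where

open import Defs
open import Data.Bool using (Bool; true; false)
open import Data.Bool.Properties using (⇔→≡)
open import Data.Empty using (⊥-elim)
open import Data.Fin using (Fin; toℕ; fromℕ<) renaming (zero to 0F)
open import Data.Fin.Properties using (toℕ-injective; toℕ<n; fromℕ<-toℕ; toℕ-fromℕ<; all?; ¬∀⟶∃¬) renaming (_≟_ to _≟F_)
open import Data.List using (List; []; _∷_; length; tabulate; _++_)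
open import Data.List.Membership.Propositional using (_∈_; _─_; lose)
open import Data.List.Membership.Propositional.Properties using (∈-tabulate⁺; ∈-tabulate⁻; ∈-++⁺ˡ; ∈-++⁺ʳ)
open import Data.List.Properties using (length-removeAt′; length-tabulate)
open import Data.List.Relation.Binary.Subset.Propositional using (_⊆_)
open import Data.List.Relation.Unary.All as All using (All)
open import Data.List.Relation.Unary.AllPairs using (_∷_)
open import Data.List.Relation.Unary.Any using (here; there; index; any?; satisfied)
open import Data.List.Relation.Unary.Unique.Propositional using (Unique)
open import Data.List.Relation.Unary.Unique.Propositional.Properties using (tabulate⁺)
open import Data.Nat using (ℕ; NonZero; zero; suc; _+_; _⊓_; _≤_; _<_; z≤n; s≤s; z<s; ∣_-_∣; _%_; _≟_)
open import Data.Nat.DivMod using (m<n⇒m%n≡m; n%n≡0; m%n<n)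
open import Data.Nat.Properties
open import Data.Product using (Σ; ∃; _×_; _,_; proj₁; proj₂)
open import Data.Product.Properties using (≡-dec)
open import Data.Sum using (_⊎_; inj₁; inj₂; [_,_]′)
import Data.Sum as Sum
open import Function using (_∘_; mk⇔)
open import Relation.Binary.Definitions using (Symmetric; Decidable)
open import Relation.Binary.PropositionalEquality using (_≡_; _≢_; refl; sym; trans; cong; cong₂; subst; subst₂; ≢-sym; module ≡-Reasoning)
open import Relation.Nullary using (¬_; Dec; yes; no)
open import Relation.Nullary.Decidable using (_×-dec_)

module _ {A : Set} where

  ∈-─⁺ : ∀ {x y : A} {xs} (x∈xs : x ∈ xs) → y ∈ xs → y ≢ x → y ∈ xs ─ x∈xs
  ∈-─⁺ (here refl) (here refl) y≢x = ⊥-elim (y≢x refl)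
  ∈-─⁺ (here refl) (there y∈xs) _ = y∈xs
  ∈-─⁺ (there x∈xs) (here refl) _ = here refl
  ∈-─⁺ (there x∈xs) (there y∈xs) y≢x = there (∈-─⁺ x∈xs y∈xs y≢x)

  Unique⇒length≤ : ∀ {xs ys : List A} → Unique xs → xs ⊆ ys → length xs ≤ length ys
  Unique⇒length≤ {[]} _ _ = z≤n
  Unique⇒length≤ {x ∷ xs} {ys} (x∉xs ∷ uxs) xs⊆ys = begin
    suc (length xs)          ≤⟨ s≤s (Unique⇒length≤ uxs xs⊆ys─x) ⟩
    suc (length (ys ─ x∈ys)) ≡⟨ length-removeAt′ ys (index x∈ys) ⟨
    length ys                ∎
    where
    open ≤-Reasoning
    x∈ys : x ∈ ys
    x∈ys = xs⊆ys (here refl)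
    xs⊆ys─x : xs ⊆ ys ─ x∈ys
    xs⊆ys─x z∈xs = ∈-─⁺ x∈ys (xs⊆ys (there z∈xs)) (≢-sym (All.lookup x∉xs z∈xs))

module _ {P : ℕ → Set} (P? : ∀ k → Dec (P k)) where

  private
    noneBelow-or-least : ∀ K →
      (∀ j → j < K → ¬ P j) ⊎ Σ ℕ λ k → P k × (∀ j → P j → k ≤ j)
    noneBelow-or-least zero = inj₁ λ _ ()
    noneBelow-or-least (suc K) with noneBelow-or-least K
    ... | inj₂ least = inj₂ least
    ... | inj₁ none with P? K
    ...   | yes pK = inj₂ (K , pK , λ j pj → ≮⇒≥ λ j<K → none j j<K pj)
    ...   | no ¬pK = inj₁ λ j j<1+K → [ none j , (λ { refl → ¬pK }) ]′ (m<1+n⇒m<n∨m≡n j<1+K)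

  least : ∀ {K} → P K → Σ ℕ λ k → P k × (∀ j → P j → k ≤ j)
  least {K} pK with noneBelow-or-least (suc K)
  ... | inj₁ none = ⊥-elim (none K (n<1+n K) pK)
  ... | inj₂ least = least

⊓≡⇒≡⊎≡ : ∀ {a b c} → a ⊓ b ≡ c → a ≡ c ⊎ b ≡ c
⊓≡⇒≡⊎≡ {a} {b} a⊓b≡c =
  Sum.map (λ e → trans (sym e) a⊓b≡c) (λ e → trans (sym e) a⊓b≡c) (⊓-sel a b)

module Graph {V : Set} (adj : V → V → Set) (adj-sym : Symmetric adj) where

  private variable
    u v w x y z : V
    a b d k l : ℕ

  snoc : Walk adj u v k → adj v w → Walk adj u w (suc k)
  snoc here e = step e here
  snoc (step e walk) e′ = step e (snoc walk e′)

  reverse : Walk adj u v k → Walk adj v u k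
  reverse here = here
  reverse (step e walk) = snoc (reverse walk) (adj-sym e)

  _++ʷ_ : Walk adj u v k → Walk adj v w l → Walk adj u w (k + l)
  here ++ʷ walk′ = walk′
  step e walk ++ʷ walk′ = step e (walk ++ʷ walk′)

  Dist-unique : Dist adj u v a → Dist adj u v b → a ≡ b
  Dist-unique (walk-a , min-a) (walk-b , min-b) = ≤-antisym (min-a _ walk-b) (min-b _ walk-a)

  Dist-refl : Dist adj u u 0
  Dist-refl = here , λ _ _ → z≤n

  Dist-0⇒≡ : Dist adj u v 0 → u ≡ v
  Dist-0⇒≡ (here , _) = refl

  Dist-adj : adj u v → u ≢ v → Dist adj u v 1
  Dist-adj e u≢v = step e here , λ where
    zero here → ⊥-elim (u≢v refl)
    (suc _) _ → s≤s z≤n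

  ProjectsEdge : (V → V) → (V → ℕ) → V → V → Set
  ProjectsEdge ψ t u w =
    (adj (ψ u) (ψ w) × t u ≡ t w) ⊎ (ψ u ≡ ψ w × ∣ t u - t w ∣ ≤ 1)

  ProjectsEdge-sym : ∀ {ψ t} → ProjectsEdge ψ t u w → ProjectsEdge ψ t w u
  ProjectsEdge-sym (inj₁ (e , t≡)) = inj₁ (adj-sym e , sym t≡)
  ProjectsEdge-sym {u} {w} {t = t} (inj₂ (ψ≡ , Δ≤1)) =
    inj₂ (sym ψ≡ , subst (_≤ 1) (∣-∣-comm (t u) (t w)) Δ≤1)

  Projection : (V → V) → (V → ℕ) → Set
  Projection ψ t = ∀ {u w} → adj u w → ProjectsEdge ψ t u w

  walk-project : ∀ {ψ t} → Projection ψ t → Walk adj u v k →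
    Σ ℕ λ k′ → Walk adj (ψ u) (ψ v) k′ × ∣ t u - t v ∣ + k′ ≤ k
  walk-project {u} {t = t} proj here = 0 , here , ≤-reflexive (cong (_+ 0) (∣n-n∣≡0 (t u)))
  walk-project {u} {v} {ψ = ψ} {t} proj (step {w = w} {k = k} e walk)
    with walk-project proj walk | proj e
  ... | k′ , walk′ , bound | inj₁ (e′ , t≡) =
    suc k′ , step e′ walk′ ,
    subst (_≤ suc k) (sym (+-suc _ k′))
      (s≤s (subst (λ s → ∣ s - t v ∣ + k′ ≤ k) (sym t≡) bound))
  ... | k′ , walk′ , bound | inj₂ (ψ≡ , Δ≤1) =
    k′ , subst (λ s → Walk adj s (ψ v) k′) (sym ψ≡) walk′ , (begin
      ∣ t u - t v ∣ + k′                   ≤⟨ +-monoˡ-≤ k′ (∣-∣-triangle (t u) (t w) (t v)) ⟩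
      ∣ t u - t w ∣ + ∣ t w - t v ∣ + k′   ≤⟨ +-monoˡ-≤ k′ (+-monoˡ-≤ _ Δ≤1) ⟩
      suc (∣ t w - t v ∣ + k′)             ≤⟨ s≤s bound ⟩
      suc k                                ∎)
    where open ≤-Reasoning

  Dist-lift : ∀ {ψ t} → Projection ψ t → ψ z ≡ z → ψ y ≡ x → Dist adj z x d →
    Walk adj z y (∣ t z - t y ∣ + d) → Dist adj z y (∣ t z - t y ∣ + d)
  Dist-lift {z} {y} {x} {d} {t = t} proj ψz≡z ψy≡x (_ , min) walk = walk , bound
    where
    bound : ∀ j → Walk adj z y j → ∣ t z - t y ∣ + d ≤ j
    bound j walk′ with walk-project proj walk′
    ... | k′ , walk″ , k′-bound =
      ≤-trans (+-monoʳ-≤ _ (min k′ (subst₂ (λ s s′ → Walk adj s s′ k′) ψz≡z ψy≡x walk″)))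
        k′-bound

  Pendant : V → V → Set
  Pendant leaf stem = adj stem leaf × (∀ {w} → adj leaf w → w ≡ stem)

  Dist-pendant : ∀ {leaf stem} → Pendant leaf stem → z ≢ leaf →
    Dist adj z stem d → Dist adj z leaf (suc d)
  Dist-pendant {z} {d} {leaf} (e , only-stem) z≢leaf (walk , min) =
    snoc walk e , λ j walk′ → bound (reverse walk′)
    where
    bound : ∀ {j} → Walk adj leaf z j → suc d ≤ j
    bound here = ⊥-elim (z≢leaf refl)
    bound (step e′ walk′) =
      s≤s (min _ (reverse (subst (λ s → Walk adj s z _) (only-stem e′) walk′)))

  SameElem-sym : ∀ {y₁ y₂} → SameElem adj y₁ y₂ → SameElem adj y₂ y₁
  SameElem-sym {inj₁ _} {inj₁ _} x≡y = sym x≡y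
  SameElem-sym {inj₂ _} {inj₂ _} (inj₁ (u≡u′ , v≡v′)) = inj₁ (sym u≡u′ , sym v≡v′)
  SameElem-sym {inj₂ _} {inj₂ _} (inj₂ (u≡v′ , v≡u′)) = inj₂ (sym v≡u′ , sym u≡v′)

  SameElem-trans : ∀ {y₁ y₂ y₃} →
    SameElem adj y₁ y₂ → SameElem adj y₂ y₃ → SameElem adj y₁ y₃
  SameElem-trans {inj₁ _} {inj₁ _} {inj₁ _} x≡y y≡z = trans x≡y y≡z
  SameElem-trans {inj₂ _} {inj₂ _} {inj₂ _} (inj₁ (a , b)) (inj₁ (c , d)) = inj₁ (trans a c , trans b d)
  SameElem-trans {inj₂ _} {inj₂ _} {inj₂ _} (inj₁ (a , b)) (inj₂ (c , d)) = inj₂ (trans a c , trans b d)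
  SameElem-trans {inj₂ _} {inj₂ _} {inj₂ _} (inj₂ (a , b)) (inj₁ (c , d)) = inj₂ (trans a d , trans b c)
  SameElem-trans {inj₂ _} {inj₂ _} {inj₂ _} (inj₂ (a , b)) (inj₂ (c , d)) = inj₁ (trans a d , trans b c)

  DistEl-resp : ∀ {y₁ y₂} → SameElem adj y₁ y₂ → DistEl adj z y₁ a → DistEl adj z y₂ a
  DistEl-resp {y₁ = inj₁ _} {inj₁ _} refl D = D
  DistEl-resp {y₁ = inj₂ _} {inj₂ _} (inj₁ (refl , refl)) D = D
  DistEl-resp {y₁ = inj₂ _} {inj₂ _} (inj₂ (refl , refl)) (a , b , Da , Db , c≡a⊓b) =
    b , a , Db , Da , trans c≡a⊓b (⊓-comm a b)

  DistEl-edge : (e : adj u v) → Dist adj z u a → Dist adj z v b →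
    DistEl adj z (inj₂ ((u , v) , e)) d → d ≡ a ⊓ b
  DistEl-edge _ Da Db (a′ , b′ , Da′ , Db′ , d≡a′⊓b′) =
    trans d≡a′⊓b′ (cong₂ _⊓_ (Dist-unique Da′ Da) (Dist-unique Db′ Db))

  nearer-endpoint-indistinct : (e : adj u v) → Dist adj z u a → Dist adj z v b → a ≤ b →
    ¬ Distinguishes adj z (inj₁ u) (inj₂ ((u , v) , e))
  nearer-endpoint-indistinct {a = a} {b} e Da Db a≤b distinguishes =
    distinguishes a (a ⊓ b) Da (a , b , Da , Db , refl) (sym (m≤n⇒m⊓n≡m a≤b))

  module Finite (vertices : List V) (∈vertices : ∀ x → x ∈ vertices)
                (_≟V_ : Decidable {A = V} _≡_) (adj? : Decidable adj)
                (connected : ∀ x y → Σ ℕ (Walk adj x y)) where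

    walk? : ∀ u v k → Dec (Walk adj u v k)
    walk? u v zero with u ≟V v
    ... | yes refl = yes here
    ... | no u≢v = no λ { here → u≢v refl }
    walk? u v (suc k) with any? (λ w → adj? u w ×-dec walk? w v k) vertices
    ... | yes found = let _ , e , walk = satisfied found in yes (step e walk)
    ... | no none = no λ { (step {w = w} e walk) → none (lose (∈vertices w) (e , walk)) }

    dist : V → V → ℕ
    dist u v = proj₁ (least (walk? u v) (proj₂ (connected u v)))

    dist-spec : ∀ u v → Dist adj u v (dist u v)
    dist-spec u v = proj₂ (least (walk? u v) (proj₂ (connected u v)))

    dist≡ : Dist adj u v d → dist u v ≡ d
    dist≡ = Dist-unique (dist-spec _ _)

    dist≡0⇒≡ : dist u v ≡ 0 → u ≡ v
    dist≡0⇒≡ {u} {v} d≡0 = Dist-0⇒≡ (subst (Dist adj u v) d≡0 (dist-spec u v))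

    pendant∈generator : ∀ {leaf stem M} → Pendant leaf stem →
      MixedMetricGenerator adj M → leaf ∈ M
    pendant∈generator {leaf} {stem} pendant@(e , _) generator
      with generator (inj₁ stem) (inj₂ ((stem , leaf) , e)) (λ ())
    ... | z , z∈M , distinguishes with z ≟V leaf
    ...   | yes refl = z∈M
    ...   | no z≢leaf = ⊥-elim (nearer-endpoint-indistinct e (dist-spec z stem)
              (Dist-pendant pendant z≢leaf (dist-spec z stem)) (n≤1+n _) distinguishes)

module NearPositions {A : Set} (f : A → A)
                     (f-nofix : ∀ x → f x ≢ x) (f²-nofix : ∀ x → f (f x) ≢ x) where

  Near : Bool → A → A → Set
  Near b j i = i ≡ j ⊎ (b ≡ true × i ≡ f j)

  private
    Near-flag : ∀ {b₁ b₂ j} → (∀ {i} → Near b₁ j i → Near b₂ j i) → b₁ ≡ true → b₂ ≡ true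
    Near-flag to refl with to (inj₂ (refl , refl))
    ... | inj₁ fj≡j = ⊥-elim (f-nofix _ fj≡j)
    ... | inj₂ (b₂≡true , _) = b₂≡true

    Near-flag-≡ : ∀ {b₁ b₂ j} → (∀ {i} → Near b₁ j i → Near b₂ j i) →
      (∀ {i} → Near b₂ j i → Near b₁ j i) → b₁ ≡ b₂
    Near-flag-≡ to from = ⇔→≡ (mk⇔ (Near-flag to) (Near-flag from))

  Near-injective : ∀ {b₁ b₂ j₁ j₂} → (∀ {i} → Near b₁ j₁ i → Near b₂ j₂ i) →
    (∀ {i} → Near b₂ j₂ i → Near b₁ j₁ i) → j₁ ≡ j₂ × b₁ ≡ b₂
  Near-injective to from with to (inj₁ refl) | from (inj₁ refl)
  ... | inj₁ refl | _ = refl , Near-flag-≡ to from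
  ... | inj₂ _ | inj₁ refl = refl , Near-flag-≡ to from
  ... | inj₂ (_ , j₁≡fj₂) | inj₂ (_ , j₂≡fj₁) =
    ⊥-elim (f²-nofix _ (trans (cong f (sym j₂≡fj₁)) (sym j₁≡fj₂)))

module Web (m : ℕ) (2≤m : 2 ≤ m) where

  n : ℕ
  n = suc m

  V : Set
  V = WebVertex n

  A : V → V → Set
  A = WebAdj n

  A-sym : Symmetric A
  A-sym = Sum.swap

  open Graph A A-sym

  _≟K_ : Decidable {A = Kind} _≡_
  p ≟K p = yes refl
  p ≟K q = no λ ()
  p ≟K r = no λ ()
  q ≟K p = no λ ()
  q ≟K q = yes refl
  q ≟K r = no λ ()
  r ≟K p = no λ ()
  r ≟K q = no λ ()
  r ≟K r = yes refl

  _≟V_ : Decidable {A = V} _≡_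
  _≟V_ = ≡-dec _≟K_ _≟F_

  next? : ∀ i j → Dec (Next n i j)
  next? i j = toℕ j ≟ suc (toℕ i) % n

  edge? : Decidable (WebEdge n)
  edge? (p , i) (p , j) with next? i j
  ... | yes e = yes (pp i j e)
  ... | no ¬e = no λ { (pp _ _ e) → ¬e e }
  edge? (p , i) (q , j) with i ≟F j
  ... | yes refl = yes (pq i)
  ... | no i≢j = no λ { (pq _) → i≢j refl }
  edge? (p , i) (r , j) = no λ ()
  edge? (q , i) (p , j) = no λ ()
  edge? (q , i) (q , j) with next? i j
  ... | yes e = yes (qq i j e)
  ... | no ¬e = no λ { (qq _ _ e) → ¬e e }
  edge? (q , i) (r , j) with i ≟F j
  ... | yes refl = yes (qr i)
  ... | no i≢j = no λ { (qr _) → i≢j refl }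
  edge? (r , i) y = no λ ()

  adj? : Decidable A
  adj? x y with edge? x y | edge? y x
  ... | yes e | _ = yes (inj₁ e)
  ... | no _ | yes e = yes (inj₂ e)
  ... | no ¬e | no ¬e′ = no λ { (inj₁ e) → ¬e e ; (inj₂ e) → ¬e′ e }

  vertices : List V
  vertices = tabulate (p ,_) ++ tabulate (q ,_) ++ tabulate (r ,_)

  ∈vertices : ∀ x → x ∈ vertices
  ∈vertices (p , i) = ∈-++⁺ˡ (∈-tabulate⁺ {f = p ,_} i)
  ∈vertices (q , i) = ∈-++⁺ʳ (tabulate (p ,_)) (∈-++⁺ˡ (∈-tabulate⁺ {f = q ,_} i))
  ∈vertices (r , i) =
    ∈-++⁺ʳ (tabulate (p ,_)) (∈-++⁺ʳ (tabulate (q ,_)) (∈-tabulate⁺ {f = r ,_} i))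

  q-walk : ∀ k (k<n : k < n) → Σ ℕ (Walk A (q , 0F) (q , fromℕ< k<n))
  q-walk zero _ = 0 , here
  q-walk (suc k) 1+k<n =
    let k<n = <-trans (n<1+n k) 1+k<n
        l , walk = q-walk k k<n
    in suc l , snoc walk (inj₁ (qq _ _ (begin
      toℕ (fromℕ< 1+k<n)        ≡⟨ toℕ-fromℕ< 1+k<n ⟩
      suc k                     ≡⟨ m<n⇒m%n≡m 1+k<n ⟨
      suc k % n                 ≡⟨ cong (λ s → suc s % n) (toℕ-fromℕ< k<n) ⟨
      suc (toℕ (fromℕ< k<n)) % n ∎)))
    where open ≡-Reasoning

  walk-from-q₀ : ∀ x → Σ ℕ (Walk A (q , 0F) x)
  walk-from-q₀ (kind , i) with q-walk (toℕ i) (toℕ<n i)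
  ... | l , walk with subst (λ j → Walk A (q , 0F) (q , j) l) (fromℕ<-toℕ i (toℕ<n i)) walk
  ...   | walk-to-qᵢ with kind
  ...     | p = suc l , snoc walk-to-qᵢ (inj₂ (pq i))
  ...     | q = l , walk-to-qᵢ
  ...     | r = suc l , snoc walk-to-qᵢ (inj₁ (qr i))

  connected : ∀ x y → Σ ℕ (Walk A x y)
  connected x y with walk-from-q₀ x | walk-from-q₀ y
  ... | k , to-x | l , to-y = k + l , reverse to-x ++ʷ to-y

  open Finite vertices ∈vertices _≟V_ adj? connected

  next : Fin n → Fin n
  next i = fromℕ< (m%n<n (suc (toℕ i)) n)

  Next-next : ∀ i → Next n i (next i)
  Next-next i = toℕ-fromℕ< (m%n<n (suc (toℕ i)) n)

  Next⇒≡next : ∀ {i j} → Next n i j → j ≡ next i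
  Next⇒≡next {i} e = toℕ-injective (trans e (sym (Next-next i)))

  toℕ-next : ∀ i → toℕ (next i) ≡ suc (toℕ i) ⊎ (toℕ i ≡ m × toℕ (next i) ≡ 0)
  toℕ-next i with m<1+n⇒m<n∨m≡n (toℕ<n i)
  ... | inj₁ i<m = inj₁ (trans (Next-next i) (m<n⇒m%n≡m (s≤s i<m)))
  ... | inj₂ i≡m =
    inj₂ (i≡m , trans (Next-next i) (trans (cong (λ s → suc s % n) i≡m) (n%n≡0 n)))

  private
    0≢m : 0 ≢ m
    0≢m = <⇒≢ (≤-trans (s≤s z≤n) 2≤m)

    1≢m : 1 ≢ m
    1≢m = <⇒≢ 2≤m

  next-nofix : ∀ i → next i ≢ i
  next-nofix i next≡i with toℕ-next i | cong toℕ next≡i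
  ... | inj₁ e | e′ = 1+n≢n (trans (sym e) e′)
  ... | inj₂ (i≡m , e) | e′ = 0≢m (trans (sym e) (trans e′ i≡m))

  next²-nofix : ∀ i → next (next i) ≢ i
  next²-nofix i next²≡i with toℕ-next i | toℕ-next (next i) | cong toℕ next²≡i
  ... | inj₁ e | inj₁ e′ | e″ =
    <⇒≢ (m<n+m (toℕ i) {2} z<s) (sym (trans (sym (trans e′ (cong suc e))) e″))
  ... | inj₁ e | inj₂ (e′ , e″) | e‴ =
    1≢m (trans (cong suc (sym (trans (sym e‴) e″))) (trans (sym e) e′))
  ... | inj₂ (e , e′) | inj₁ e″ | e‴ =
    1≢m (trans (cong suc (sym e′)) (trans (sym e″) (trans e‴ e)))
  ... | inj₂ (_ , e) | inj₂ (e′ , _) | _ = 0≢m (trans (sym e) e′)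

  lift-projection : ∀ {ψ t} → (∀ {u w} → WebEdge n u w → ProjectsEdge ψ t u w) → Projection ψ t
  lift-projection project (inj₁ e) = project e
  lift-projection {ψ} {t} project (inj₂ e) = ProjectsEdge-sym {ψ = ψ} {t} (project e)

  p↦q : V → V
  p↦q (p , i) = q , i
  p↦q x = x

  [p] : V → ℕ
  [p] (p , _) = 1
  [p] _ = 0

  p↦q-projection : Projection p↦q [p]
  p↦q-projection = lift-projection λ where
    (pq i) → inj₂ (refl , ≤-refl)
    (pp i j e) → inj₁ (inj₁ (qq i j e) , refl)
    (qq i j e) → inj₁ (inj₁ (qq i j e) , refl)
    (qr i) → inj₁ (inj₁ (qr i) , refl)

  ↦p : V → V
  ↦p (_ , i) = p , i

  level : V → ℕ
  level (p , _) = 0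
  level (q , _) = 1
  level (r , _) = 2

  ↦p-projection : Projection ↦p level
  ↦p-projection = lift-projection λ where
    (pq i) → inj₂ (refl , ≤-refl)
    (pp i j e) → inj₁ (inj₁ (pp i j e) , refl)
    (qq i j e) → inj₁ (inj₁ (pp i j e) , refl)
    (qr i) → inj₂ (refl , ≤-refl)

  r-pendant : ∀ i → Pendant (r , i) (q , i)
  r-pendant i = inj₁ (qr i) , λ { (inj₁ ()) ; (inj₂ (qr _)) → refl }

  dist-rp : ∀ i j → dist (r , i) (p , j) ≡ suc (dist (r , i) (q , j))
  dist-rp i j = dist≡ (Dist-lift p↦q-projection refl refl rq
    (snoc (proj₁ rq) (inj₂ (pq j))))
    where
    rq : Dist A (r , i) (q , j) (dist (r , i) (q , j))
    rq = dist-spec (r , i) (q , j)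

  dist-rq-pos : ∀ i j → 1 ≤ dist (r , i) (q , j)
  dist-rq-pos i j = n≢0⇒n>0 λ d≡0 → r≢q (dist≡0⇒≡ d≡0)
    where
    r≢q : (r , i) ≢ (q , j)
    r≢q ()

  dist-rq≡1⇒≡ : ∀ {i j} → dist (r , i) (q , j) ≡ 1 → i ≡ j
  dist-rq≡1⇒≡ {i} {j} d≡1 with subst (Dist A (r , i) (q , j)) d≡1 (dist-spec _ _)
  ... | step e here , _ = sym (cong proj₂ (proj₂ (r-pendant i) e))

  dist-rq-self : ∀ i → dist (r , i) (q , i) ≡ 1
  dist-rq-self i = dist≡ (Dist-adj (inj₂ (qr i)) λ ())

  p₀ : V
  p₀ = p , 0F

  Dist-p₀q : ∀ j → Dist A p₀ (q , j) (suc (dist p₀ (p , j)))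
  Dist-p₀q j = Dist-lift ↦p-projection refl refl p₀p (snoc (proj₁ p₀p) (inj₁ (pq j)))
    where
    p₀p : Dist A p₀ (p , j) (dist p₀ (p , j))
    p₀p = dist-spec p₀ (p , j)

  dist-p₀q : ∀ j → dist p₀ (q , j) ≡ suc (dist p₀ (p , j))
  dist-p₀q j = dist≡ (Dist-p₀q j)

  dist-p₀r : ∀ j → dist p₀ (r , j) ≡ suc (suc (dist p₀ (p , j)))
  dist-p₀r j = dist≡ (Dist-pendant (r-pendant j) (λ ()) (Dist-p₀q j))

  Rs : List V
  Rs = tabulate (r ,_)

  length-Rs : length Rs ≡ n
  length-Rs = length-tabulate (r ,_)

  non-r∷Rs-unique : ∀ {z} → proj₁ z ≢ r → Unique (z ∷ Rs)
  non-r∷Rs-unique z≢r =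
    All.tabulate (λ x∈Rs z≡x →
      z≢r (cong proj₁ (trans z≡x (proj₂ (∈-tabulate⁻ {f = r ,_} x∈Rs)))))
    ∷ tabulate⁺ {f = r ,_} (cong proj₂)

  -- Seen from r_i, p₀ lies behind q₀, so r_i cannot tell q₀ from the edge q₀p₀.
  non-r-landmark : ∀ {M} → MixedMetricGenerator A M → Σ V λ z → z ∈ M × proj₁ z ≢ r
  non-r-landmark generator
    with generator (inj₁ (q , 0F)) (inj₂ (((q , 0F) , p₀) , inj₂ (pq 0F))) (λ ())
  ... | (kind , i) , z∈M , distinguishes with kind ≟K r
  ...   | no kind≢r = _ , z∈M , kind≢r
  ...   | yes refl = ⊥-elim (nearer-endpoint-indistinct (inj₂ (pq 0F))
            (dist-spec _ _) (subst (Dist A (r , i) p₀) (dist-rp i 0F) (dist-spec _ _))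
            (n≤1+n _) distinguishes)

  lower-bound : ∀ {M} → MixedMetricGenerator A M → suc n ≤ length M
  lower-bound {M} generator with non-r-landmark generator
  ... | z , z∈M , z≢r =
    subst (_≤ length M) (cong suc length-Rs) (Unique⇒length≤ (non-r∷Rs-unique z≢r) z∷Rs⊆M)
    where
    z∷Rs⊆M : (z ∷ Rs) ⊆ M
    z∷Rs⊆M (here refl) = z∈M
    z∷Rs⊆M (there x∈Rs) with ∈-tabulate⁻ {f = r ,_} x∈Rs
    ... | i , refl = pendant∈generator (r-pendant i) generator

  data Tag : Set where
    vp vq vr epp eqq epq eqr : Tag

  Element : Set
  Element = Fin n × Tag

  ⟦_⟧ : Element → Elem A
  ⟦ j , vp ⟧ = inj₁ (p , j)
  ⟦ j , vq ⟧ = inj₁ (q , j)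
  ⟦ j , vr ⟧ = inj₁ (r , j)
  ⟦ j , epp ⟧ = inj₂ (((p , j) , (p , next j)) , inj₁ (pp j (next j) (Next-next j)))
  ⟦ j , eqq ⟧ = inj₂ (((q , j) , (q , next j)) , inj₁ (qq j (next j) (Next-next j)))
  ⟦ j , epq ⟧ = inj₂ (((p , j) , (q , j)) , inj₁ (pq j))
  ⟦ j , eqr ⟧ = inj₂ (((q , j) , (r , j)) , inj₁ (qr j))

  element : Elem A → Element
  element (inj₁ (p , j)) = j , vp
  element (inj₁ (q , j)) = j , vq
  element (inj₁ (r , j)) = j , vr
  element (inj₂ (_ , inj₁ (pp j _ _))) = j , epp
  element (inj₂ (_ , inj₁ (qq j _ _))) = j , eqq
  element (inj₂ (_ , inj₁ (pq j))) = j , epq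
  element (inj₂ (_ , inj₁ (qr j))) = j , eqr
  element (inj₂ (_ , inj₂ (pp j _ _))) = j , epp
  element (inj₂ (_ , inj₂ (qq j _ _))) = j , eqq
  element (inj₂ (_ , inj₂ (pq j))) = j , epq
  element (inj₂ (_ , inj₂ (qr j))) = j , eqr

  SameElem-element : ∀ y → SameElem A y ⟦ element y ⟧
  SameElem-element (inj₁ (p , j)) = refl
  SameElem-element (inj₁ (q , j)) = refl
  SameElem-element (inj₁ (r , j)) = refl
  SameElem-element (inj₂ (_ , inj₁ (pp j _ e))) = inj₁ (refl , cong (p ,_) (Next⇒≡next e))
  SameElem-element (inj₂ (_ , inj₁ (qq j _ e))) = inj₁ (refl , cong (q ,_) (Next⇒≡next e))
  SameElem-element (inj₂ (_ , inj₁ (pq j))) = inj₁ (refl , refl)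
  SameElem-element (inj₂ (_ , inj₁ (qr j))) = inj₁ (refl , refl)
  SameElem-element (inj₂ (_ , inj₂ (pp j _ e))) = inj₂ (cong (p ,_) (Next⇒≡next e) , refl)
  SameElem-element (inj₂ (_ , inj₂ (qq j _ e))) = inj₂ (cong (q ,_) (Next⇒≡next e) , refl)
  SameElem-element (inj₂ (_ , inj₂ (pq j))) = inj₂ (refl , refl)
  SameElem-element (inj₂ (_ , inj₂ (qr j))) = inj₂ (refl , refl)

  dist-to : V → Element → ℕ
  dist-to z (j , vp) = dist z (p , j)
  dist-to z (j , vq) = dist z (q , j)
  dist-to z (j , vr) = dist z (r , j)
  dist-to z (j , epp) = dist z (p , j) ⊓ dist z (p , next j)
  dist-to z (j , eqq) = dist z (q , j) ⊓ dist z (q , next j)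
  dist-to z (j , epq) = dist z (p , j) ⊓ dist z (q , j)
  dist-to z (j , eqr) = dist z (q , j) ⊓ dist z (r , j)

  DistEl⇒dist-to : ∀ z c {a} → DistEl A z ⟦ c ⟧ a → a ≡ dist-to z c
  DistEl⇒dist-to z (j , vp) D = Dist-unique D (dist-spec _ _)
  DistEl⇒dist-to z (j , vq) D = Dist-unique D (dist-spec _ _)
  DistEl⇒dist-to z (j , vr) D = Dist-unique D (dist-spec _ _)
  DistEl⇒dist-to z (j , epp) = DistEl-edge (inj₁ (pp j _ (Next-next j))) (dist-spec _ _) (dist-spec _ _)
  DistEl⇒dist-to z (j , eqq) = DistEl-edge (inj₁ (qq j _ (Next-next j))) (dist-spec _ _) (dist-spec _ _)
  DistEl⇒dist-to z (j , epq) = DistEl-edge (inj₁ (pq j)) (dist-spec _ _) (dist-spec _ _)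
  DistEl⇒dist-to z (j , eqr) = DistEl-edge (inj₁ (qr j)) (dist-spec _ _) (dist-spec _ _)

  -- The least distance from an r-vertex to an element of the given kind.
  base : Tag → ℕ
  base vp = 2
  base vq = 1
  base vr = 0
  base epp = 2
  base eqq = 1
  base epq = 1
  base eqr = 0

  along : Tag → Bool
  along epp = true
  along eqq = true
  along _ = false

  open NearPositions next next-nofix next²-nofix

  NearR : Fin n → Element → Set
  NearR i (j , t) = Near (along t) j i

  dq : Fin n → Fin n → ℕ
  dq i j = dist (r , i) (q , j)

  dist-r-epp : ∀ i j → dist-to (r , i) (j , epp) ≡ suc (dist-to (r , i) (j , eqq))
  dist-r-epp i j = cong₂ _⊓_ (dist-rp i j) (dist-rp i (next j))

  dist-r-epq : ∀ i j → dist-to (r , i) (j , epq) ≡ dq i j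
  dist-r-epq i j = trans (cong (_⊓ dq i j) (dist-rp i j)) (m≥n⇒m⊓n≡n (n≤1+n _))

  dist-r-eqq-pos : ∀ i j → 1 ≤ dist-to (r , i) (j , eqq)
  dist-r-eqq-pos i j = ⊓-glb (dist-rq-pos i j) (dist-rq-pos i (next j))

  dist-r-eqq≡1⇒Near : ∀ {i j} → dist-to (r , i) (j , eqq) ≡ 1 → Near true j i
  dist-r-eqq≡1⇒Near e = Sum.map dist-rq≡1⇒≡ (λ e′ → refl , dist-rq≡1⇒≡ e′) (⊓≡⇒≡⊎≡ e)

  Near⇒dist-r-eqq≡1 : ∀ {i j} → Near true j i → dist-to (r , i) (j , eqq) ≡ 1
  Near⇒dist-r-eqq≡1 {j = j} (inj₁ refl) =
    trans (cong (_⊓ dq j (next j)) (dist-rq-self j)) (m≤n⇒m⊓n≡m (dist-rq-pos j (next j)))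
  Near⇒dist-r-eqq≡1 {j = j} (inj₂ (_ , refl)) =
    trans (cong (dq (next j) j ⊓_) (dist-rq-self (next j))) (m≥n⇒m⊓n≡n (dist-rq-pos (next j) j))

  base≤dist-r : ∀ i c → base (proj₂ c) ≤ dist-to (r , i) c
  base≤dist-r i (j , vp) rewrite dist-rp i j = s≤s (dist-rq-pos i j)
  base≤dist-r i (j , vq) = dist-rq-pos i j
  base≤dist-r i (j , vr) = z≤n
  base≤dist-r i (j , epp) rewrite dist-r-epp i j = s≤s (dist-r-eqq-pos i j)
  base≤dist-r i (j , eqq) = dist-r-eqq-pos i j
  base≤dist-r i (j , epq) rewrite dist-r-epq i j = dist-rq-pos i j
  base≤dist-r i (j , eqr) = z≤n

  dist-r≡base⇒NearR : ∀ i c → dist-to (r , i) c ≡ base (proj₂ c) → NearR i c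
  dist-r≡base⇒NearR i (j , vp) e rewrite dist-rp i j = inj₁ (dist-rq≡1⇒≡ (suc-injective e))
  dist-r≡base⇒NearR i (j , vq) e = inj₁ (dist-rq≡1⇒≡ e)
  dist-r≡base⇒NearR i (j , vr) e = inj₁ (cong proj₂ (dist≡0⇒≡ {r , i} {r , j} e))
  dist-r≡base⇒NearR i (j , epp) e rewrite dist-r-epp i j = dist-r-eqq≡1⇒Near (suc-injective e)
  dist-r≡base⇒NearR i (j , eqq) e = dist-r-eqq≡1⇒Near e
  dist-r≡base⇒NearR i (j , epq) e rewrite dist-r-epq i j = inj₁ (dist-rq≡1⇒≡ e)
  dist-r≡base⇒NearR i (j , eqr) e with ⊓≡⇒≡⊎≡ e
  ... | inj₁ dq≡0 = ⊥-elim (<⇒≢ (dist-rq-pos i j) (sym dq≡0))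
  ... | inj₂ dr≡0 = inj₁ (cong proj₂ (dist≡0⇒≡ {r , i} {r , j} dr≡0))

  NearR⇒dist-r≡base : ∀ i c → NearR i c → dist-to (r , i) c ≡ base (proj₂ c)
  NearR⇒dist-r≡base i (j , vp) (inj₁ refl) = trans (dist-rp j j) (cong suc (dist-rq-self j))
  NearR⇒dist-r≡base i (j , vq) (inj₁ refl) = dist-rq-self j
  NearR⇒dist-r≡base i (j , vr) (inj₁ refl) = dist≡ (Dist-refl {u = r , j})
  NearR⇒dist-r≡base i (j , epp) near = trans (dist-r-epp i j) (cong suc (Near⇒dist-r-eqq≡1 near))
  NearR⇒dist-r≡base i (j , eqq) near = Near⇒dist-r-eqq≡1 near
  NearR⇒dist-r≡base i (j , epq) (inj₁ refl) = trans (dist-r-epq j j) (dist-rq-self j)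
  NearR⇒dist-r≡base i (j , eqr) (inj₁ refl) =
    trans (cong (dq j j ⊓_) (dist≡ (Dist-refl {u = r , j}))) (⊓-zeroʳ (dq j j))
  NearR⇒dist-r≡base i (j , vp) (inj₂ (() , _))
  NearR⇒dist-r≡base i (j , vq) (inj₂ (() , _))
  NearR⇒dist-r≡base i (j , vr) (inj₂ (() , _))
  NearR⇒dist-r≡base i (j , epq) (inj₂ (() , _))
  NearR⇒dist-r≡base i (j , eqr) (inj₂ (() , _))

  r-distances-agree : ∀ {j₁ t₁ j₂ t₂} →
    (∀ i → dist-to (r , i) (j₁ , t₁) ≡ dist-to (r , i) (j₂ , t₂)) →
    j₁ ≡ j₂ × base t₁ ≡ base t₂ × along t₁ ≡ along t₂
  r-distances-agree {j₁} {t₁} {j₂} {t₂} agree =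
    let j₁≡j₂ , along≡ = Near-injective to from in j₁≡j₂ , base≡ , along≡
    where
    base≡ : base t₁ ≡ base t₂
    base≡ = ≤-antisym
      (subst (base t₁ ≤_) (trans (agree j₂) (NearR⇒dist-r≡base j₂ (j₂ , t₂) (inj₁ refl)))
        (base≤dist-r j₂ (j₁ , t₁)))
      (subst (base t₂ ≤_) (trans (sym (agree j₁)) (NearR⇒dist-r≡base j₁ (j₁ , t₁) (inj₁ refl)))
        (base≤dist-r j₁ (j₂ , t₂)))
    to : ∀ {i} → NearR i (j₁ , t₁) → NearR i (j₂ , t₂)
    to {i} near = dist-r≡base⇒NearR i (j₂ , t₂)
      (trans (sym (agree i)) (trans (NearR⇒dist-r≡base i (j₁ , t₁) near) base≡))
    from : ∀ {i} → NearR i (j₂ , t₂) → NearR i (j₁ , t₁)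
    from {i} near = dist-r≡base⇒NearR i (j₁ , t₁)
      (trans (agree i) (trans (NearR⇒dist-r≡base i (j₂ , t₂) near) (sym base≡)))

  -- Off the cycles d(p₀, ⟦ j , t ⟧) = offset t + d(p₀, p_j); on the cycle edges offset is padding.
  offset : Tag → ℕ
  offset vp = 0
  offset vq = 1
  offset vr = 2
  offset epp = 0
  offset eqq = 0
  offset epq = 0
  offset eqr = 1

  dist-p₀ : ∀ j t → along t ≡ false → dist-to p₀ (j , t) ≡ offset t + dist p₀ (p , j)
  dist-p₀ j vp _ = refl
  dist-p₀ j vq _ = dist-p₀q j
  dist-p₀ j vr _ = dist-p₀r j
  dist-p₀ j epq _ = trans (cong (dist p₀ (p , j) ⊓_) (dist-p₀q j)) (m≤n⇒m⊓n≡m (n≤1+n _))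
  dist-p₀ j eqr _ = trans (cong₂ _⊓_ (dist-p₀q j) (dist-p₀r j)) (m≤n⇒m⊓n≡m (n≤1+n _))
  dist-p₀ j epp ()
  dist-p₀ j eqq ()

  along⇒offset≡0 : ∀ {t} → along t ≡ true → offset t ≡ 0
  along⇒offset≡0 {epp} _ = refl
  along⇒offset≡0 {eqq} _ = refl

  offset-agrees : ∀ j {t₁ t₂} → along t₁ ≡ along t₂ →
    dist-to p₀ (j , t₁) ≡ dist-to p₀ (j , t₂) → offset t₁ ≡ offset t₂
  offset-agrees j {t₁} {t₂} along≡ p₀≡ with along t₁ in along₁
  ... | true = trans (along⇒offset≡0 along₁) (sym (along⇒offset≡0 (sym along≡)))
  ... | false = +-cancelʳ-≡ (dist p₀ (p , j)) _ _
    (trans (sym (dist-p₀ j t₁ along₁)) (trans p₀≡ (dist-p₀ j t₂ (sym along≡))))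

  private
    tag : ℕ → Bool → ℕ → Tag
    tag 2 false 0 = vp
    tag 1 false 1 = vq
    tag 0 false 2 = vr
    tag 2 true _ = epp
    tag 1 true _ = eqq
    tag 1 false 0 = epq
    tag 0 false 1 = eqr
    tag _ _ _ = vp

    tag-profile : ∀ t → tag (base t) (along t) (offset t) ≡ t
    tag-profile vp = refl
    tag-profile vq = refl
    tag-profile vr = refl
    tag-profile epp = refl
    tag-profile eqq = refl
    tag-profile epq = refl
    tag-profile eqr = refl

  tag-determined : ∀ {t₁ t₂} → base t₁ ≡ base t₂ → along t₁ ≡ along t₂ →
    offset t₁ ≡ offset t₂ → t₁ ≡ t₂
  tag-determined {t₁} {t₂} base≡ along≡ offset≡ = begin
    t₁                                     ≡⟨ tag-profile t₁ ⟨
    tag (base t₁) (along t₁) (offset t₁)   ≡⟨ cong₂ (λ b a → tag b a (offset t₁)) base≡ along≡ ⟩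
    tag (base t₂) (along t₂) (offset t₁)   ≡⟨ cong (tag (base t₂) (along t₂)) offset≡ ⟩
    tag (base t₂) (along t₂) (offset t₂)   ≡⟨ tag-profile t₂ ⟩
    t₂                                     ∎
    where open ≡-Reasoning

  M₀ : List V
  M₀ = p₀ ∷ Rs

  r∈M₀ : ∀ i → (r , i) ∈ M₀
  r∈M₀ i = there (∈-tabulate⁺ {f = r ,_} i)

  Separated : Element → Element → Set
  Separated c₁ c₂ = Σ V λ z → z ∈ M₀ × Distinguishes A z ⟦ c₁ ⟧ ⟦ c₂ ⟧

  separated-by : ∀ {z} c₁ c₂ → z ∈ M₀ → dist-to z c₁ ≢ dist-to z c₂ → Separated c₁ c₂
  separated-by {z} c₁ c₂ z∈M₀ dist≢ = z , z∈M₀ , λ a b Da Db a≡b →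
    dist≢ (trans (sym (DistEl⇒dist-to z c₁ Da)) (trans a≡b (DistEl⇒dist-to z c₂ Db)))

  r-dist? : ∀ c₁ c₂ i → Dec (dist-to (r , i) c₁ ≡ dist-to (r , i) c₂)
  r-dist? c₁ c₂ i = dist-to (r , i) c₁ ≟ dist-to (r , i) c₂

  separate : ∀ c₁ c₂ → c₁ ≢ c₂ → Separated c₁ c₂
  separate c₁@(j₁ , t₁) c₂@(j₂ , t₂) c₁≢c₂ with all? (r-dist? c₁ c₂)
  ... | no disagree =
    let i , dist≢ = ¬∀⟶∃¬ n _ (r-dist? c₁ c₂) disagree
    in separated-by c₁ c₂ (r∈M₀ i) dist≢
  ... | yes agree with r-distances-agree {j₁} {t₁} {j₂} {t₂} agree
  ...   | refl , base≡ , along≡ with dist-to p₀ c₁ ≟ dist-to p₀ c₂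
  ...     | no dist≢ = separated-by c₁ c₂ (here refl) dist≢
  ...     | yes p₀≡ =
    ⊥-elim (c₁≢c₂ (cong (j₁ ,_) (tag-determined base≡ along≡ (offset-agrees j₁ along≡ p₀≡))))

  element≡⇒SameElem : ∀ {y₁ y₂} → element y₁ ≡ element y₂ → SameElem A y₁ y₂
  element≡⇒SameElem {y₁} {y₂} e = SameElem-trans (SameElem-element y₁)
    (subst (λ c → SameElem A ⟦ c ⟧ y₂) (sym e) (SameElem-sym (SameElem-element y₂)))

  M₀-generator : MixedMetricGenerator A M₀
  M₀-generator y₁ y₂ y₁≉y₂ with separate (element y₁) (element y₂) (y₁≉y₂ ∘ element≡⇒SameElem)
  ... | z , z∈M₀ , distinguishes = z , z∈M₀ , λ a b Da Db →
    distinguishes a b (DistEl-resp (SameElem-element y₁) Da) (DistEl-resp (SameElem-element y₂) Db)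

  ∈M₀⁻ : ∀ {x} → x ∈ M₀ → x ≡ p₀ ⊎ ∃ λ i → x ≡ (r , i)
  ∈M₀⁻ (here x≡p₀) = inj₁ x≡p₀
  ∈M₀⁻ (there x∈Rs) = inj₂ (∈-tabulate⁻ {f = r ,_} x∈Rs)

  M₀-not-q : ∀ {x} → x ∈ M₀ → proj₁ x ≢ q
  M₀-not-q x∈M₀ with ∈M₀⁻ x∈M₀
  ... | inj₁ refl = λ ()
  ... | inj₂ (_ , refl) = λ ()

  ¬p₀~p₀ : ¬ A p₀ p₀
  ¬p₀~p₀ (inj₁ (pp _ _ e)) = next-nofix 0F (sym (Next⇒≡next e))
  ¬p₀~p₀ (inj₂ (pp _ _ e)) = next-nofix 0F (sym (Next⇒≡next e))

  M₀-independent : IndependentSet A M₀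
  M₀-independent x y x∈M₀ y∈M₀ x~y with ∈M₀⁻ x∈M₀ | ∈M₀⁻ y∈M₀
  ... | inj₂ (i , refl) | _ = M₀-not-q y∈M₀ (cong proj₁ (proj₂ (r-pendant i) x~y))
  ... | _ | inj₂ (i , refl) = M₀-not-q x∈M₀ (cong proj₁ (proj₂ (r-pendant i) (A-sym x~y)))
  ... | inj₁ refl | inj₁ refl = ¬p₀~p₀ x~y

  M₀-unique : Unique M₀
  M₀-unique = non-r∷Rs-unique λ ()

  length-M₀ : length M₀ ≡ suc n
  length-M₀ = cong suc length-Rs

theorem8 : ∀ (n : ℕ) .{{_ : NonZero n}} → 4 ≤ n →
    IndependentMixedMetricNumber≡ (WebAdj n) (suc n)
theorem8 (suc m) (s≤s 3≤m) =
  (M₀ , M₀-unique , (M₀-independent , M₀-generator) , length-M₀) ,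
  λ _ _ (_ , generator) → lower-bound generator
  where open Web m (≤-trans (n≤1+n 2) 3≤m)
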